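{- A weighted Dyck word of size $k \ge 1$ has always a unique special weight.
   Context: Let $\star$ denote a letter representing a box of the basement. A weighted Dyck word is a word $w$ with letters in $\{\star,U,D\}\cup\mathbb{N}$ such that: (i) $w$ belongs to the language $\left(\star(U+D)\mathbb{N}(U+D)\right)^*\star$; (ii) the subword of $w$ in the letters $D$ and $U$ is a Dyck word (every prefix has at least as many $D$'s as $U$'s, with equality for the whole word); (iii) for each position $i$ with $w(i)\in\mathbb{N}$, $w(i)<ch(i,w)$, where $ch(i,w):=\left\lceil \frac{|\{ j<i \mid w(j)=D \}| - |\{ j<i \mid w(j)=U \}|}{2}\right\rceil$ is the column height. The integer letters are the weights of $w$ and the size of $w$ is its number of weights. A weight $w(i)$ is maximal if $w(i)=ch(i,w)-1$. A weight is eligible if it is maximal and the letter immediately to its left is $D$. The special weight is the right-most eligible weight. -}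

module Defs where

open import Data.Nat using (ℕ; zero; suc; _+_; _≤_; _<_; ⌈_/2⌉; _∸_)
open import Data.List using (List; []; _∷_; take; length)
open import Data.Maybe using (Maybe; just; nothing)
open import Data.Product using (Σ; _×_; ∃)
open import Relation.Binary.PropositionalEquality using (_≡_)
open import Relation.Nullary using (¬_)

-- Letters: ⋆ (box of the basement), U, D, and integer weights.
data Letter : Set where
  star : Letter
  U    : Letter
  D    : Letter
  wt   : ℕ → Letter

at : List Letter → ℕ → Maybe Letter
at []      _       = nothing
at (x ∷ w) zero    = just x
at (x ∷ w) (suc i) = at w i

#U : List Letter → ℕ
#U []       = 0
#U (U ∷ w)  = suc (#U w)
#U (_ ∷ w)  = #U w

#D : List Letter → ℕ
#D []       = 0
#D (D ∷ w)  = suc (#D w)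
#D (_ ∷ w)  = #D w

size : List Letter → ℕ
size []          = 0
size (wt _ ∷ w)  = suc (size w)
size (_ ∷ w)     = size w

udSub : List Letter → List Letter
udSub []       = []
udSub (U ∷ w)  = U ∷ udSub w
udSub (D ∷ w)  = D ∷ udSub w
udSub (_ ∷ w)  = udSub w

data IsUD : Letter → Set where
  isU : IsUD U
  isD : IsUD D

data InLang : List Letter → Set where
  base : InLang (star ∷ [])
  step : ∀ {a b n w} → IsUD a → IsUD b → InLang w →
         InLang (star ∷ a ∷ wt n ∷ b ∷ w)

-- (ii) Dyck word in letters D (up) and U (down)
IsDyck : List Letter → Set
IsDyck s = (∀ i → #U (take i s) ≤ #D (take i s)) × (#U s ≡ #D s)

-- column height ch(i,w) = ⌈ (#D before i − #U before i) / 2 ⌉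
-- (the difference is ≥ 0 for words satisfying (ii), so truncated
--  subtraction is exact there)
ch : ℕ → List Letter → ℕ
ch i w = ⌈ (#D (take i w) ∸ #U (take i w)) /2⌉

WeightsOK : List Letter → Set
WeightsOK w = ∀ i n → at w i ≡ just (wt n) → n < ch i w

record WeightedDyck (w : List Letter) : Set where
  field
    lang    : InLang w
    dyck    : IsDyck (udSub w)
    weights : WeightsOK w

Maximal : List Letter → ℕ → Set
Maximal w i = Σ ℕ λ n → (at w i ≡ just (wt n)) × (suc n ≡ ch i w)

Eligible : List Letter → ℕ → Set
Eligible w i = Maximal w i × Σ ℕ λ j → (suc j ≡ i) × (at w j ≡ just D)

Special : List Letter → ℕ → Set
Special w i = Eligible w i × (∀ j → i < j → ¬ Eligible w j)

-- Position 2 always carries an eligible weight: the Dyck condition forces the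
-- first letter after the initial ⋆ to be D, so the first column has height 1
-- and its weight must be the maximal value 0. Eligibility is decidable and
-- impossible past the end of the word, so a right-most eligible position
-- exists, and a right-most position is unique by trichotomy.
module Submission where

open import Defs
open import Data.Nat using (ℕ; zero; suc; _≤_; _<_; z≤n; s≤s; _≟_)
open import Data.Nat.Properties using (<-cmp; m≤n⇒m<n∨m≡n)
open import Data.List using (List; []; _∷_; length)
open import Data.Maybe using (Maybe; just; nothing)
open import Data.Product using (Σ; _×_; _,_; proj₁)
open import Data.Sum using (inj₁; inj₂)
open import Relation.Nullary using (¬_; Dec; yes; no; contradiction)
open import Relation.Nullary.Decidable using (_×-dec_)
open import Level using (0ℓ)
open import Relation.Unary using (Pred; Decidable)
open import Relation.Binary.PropositionalEquality using (_≡_; refl; sym; trans)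
open import Relation.Binary.Definitions using (tri<; tri≈; tri>)

Rightmost : Pred ℕ 0ℓ → ℕ → Set
Rightmost P i = P i × (∀ j → i < j → ¬ P j)

module _ {P : Pred ℕ 0ℓ} (P? : Decidable P) where

  rightmost-below : ∀ b → (∀ j → b ≤ j → ¬ P j) → ∀ {e} → P e →
    Σ ℕ (Rightmost P)
  rightmost-below zero    none {e} p = contradiction p (none e z≤n)
  rightmost-below (suc k) none p with P? k
  ... | yes pk = k , pk , none
  ... | no ¬pk = rightmost-below k none′ p
    where
      none′ : ∀ j → k ≤ j → ¬ P j
      none′ j k≤j with m≤n⇒m<n∨m≡n k≤j
      ... | inj₁ k<j  = none j k<j
      ... | inj₂ refl = ¬pk

rightmost-unique : ∀ {P : Pred ℕ 0ℓ} {i j} → Rightmost P i → Rightmost P j → i ≡ j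
rightmost-unique {i = i} {j} (pi , above-i) (pj , above-j) with <-cmp i j
... | tri< i<j _ _ = contradiction pj (above-i j i<j)
... | tri≈ _ i≡j _ = i≡j
... | tri> _ _ j<i = contradiction pi (above-j i j<i)

maximal? : ∀ w → Decidable (Maximal w)
maximal? w i with at w i
... | nothing     = no λ { (_ , () , _) }
... | just star   = no λ { (_ , () , _) }
... | just U      = no λ { (_ , () , _) }
... | just D      = no λ { (_ , () , _) }
... | just (wt n) with suc n ≟ ch i w
...   | yes max = yes (n , refl , max)
...   | no ¬max = no λ { (_ , refl , max) → ¬max max }

≡just-D? : (m : Maybe Letter) → Dec (m ≡ just D)
≡just-D? nothing       = no λ ()
≡just-D? (just star)   = no λ ()
≡just-D? (just U)      = no λ ()
≡just-D? (just D)      = yes refl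
≡just-D? (just (wt _)) = no λ ()

precededByD? : ∀ w i → Dec (Σ ℕ λ j → (suc j ≡ i) × (at w j ≡ just D))
precededByD? w zero    = no λ { (_ , () , _) }
precededByD? w (suc j) with ≡just-D? (at w j)
... | yes d = yes (j , refl , d)
... | no ¬d = no λ { (_ , refl , d) → ¬d d }

eligible? : ∀ w → Decidable (Eligible w)
eligible? w i = maximal? w i ×-dec precededByD? w i

at-beyond-length : ∀ w {i} → length w ≤ i → at w i ≡ nothing
at-beyond-length []      _           = refl
at-beyond-length (_ ∷ w) (s≤s len≤i) = at-beyond-length w len≤i

¬eligible-beyond-length : ∀ w j → length w ≤ j → ¬ Eligible w j
¬eligible-beyond-length w j len≤j ((_ , at-j , _) , _)
  with () ← trans (sym at-j) (at-beyond-length w len≤j)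

firstWeight-eligible : ∀ {w} → WeightedDyck w → 1 ≤ size w → Eligible w 2
firstWeight-eligible wd size≥1 with WeightedDyck.lang wd
... | base = contradiction size≥1 λ ()
... | step isU _ _ with () ← proj₁ (WeightedDyck.dyck wd) 1
... | step isD _ _ with s≤s z≤n ← WeightedDyck.weights wd 2 _ refl =
  (0 , refl , refl) , (1 , refl , refl)

proposition3 : (w : List Letter) → WeightedDyck w → 1 ≤ size w →
    Σ ℕ λ i → Special w i × (∀ j → Special w j → j ≡ i)
proposition3 w wd size≥1 =
  let i , special = rightmost-below (eligible? w) (length w)
                      (¬eligible-beyond-length w) (firstWeight-eligible wd size≥1)
  in i , special , λ j special-j → rightmost-unique special-j special
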